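{- Let $n=p_1\cdots p_r$ be an odd squarefree integer with primes $p_1<p_2<\cdots<p_r$, such that $n\ge 11$ and $n\ne 15$. Then $\varphi(n)>2^{r+1}\log p_1$.
   Context: $\varphi$ denotes Euler's totient function. -}

module Defs where

open import Data.Nat using (ℕ; zero; suc; _^_; _<_)
open import Data.Nat.Properties using (_!≢0)
open import Data.Nat.Coprimality using (coprime?)
open import Data.Nat.Combinatorics using ()
open import Data.Nat.Base using (_!)
open import Data.List using (List; []; _∷_; length; filter; map; upTo; foldr)
open import Data.Integer using (+_)
open import Data.Rational using (ℚ; _/_; 0ℚ) renaming (_+_ to _+ℚ_; _<_ to _<ℚ_)
open import Data.Product using (∃)

φ : ℕ → ℕ
φ n = length (filter (λ k → coprime? k n) (map suc (upTo n)))

expTerm : ℕ → ℕ → ℚ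
expTerm x k = (+ (x ^ k)) / (k !)
  where instance _ = k !≢0

expPartial : ℕ → ℕ → ℚ
expPartial x K = foldr (λ k s → expTerm x k +ℚ s) 0ℚ (upTo (suc K))

-- "N < exp x" (exp x = Σ_k x^k/k!, a limit of strictly increasing partial
-- sums): holds iff some partial sum exceeds N.
_<exp_ : ℕ → ℕ → Set
N <exp x = ∃ λ K → ((+ N) / 1) <ℚ expPartial x K

{-# OPTIONS --safe #-}
-- Since p₁, …, p_r are distinct primes, φ(n) = ∏ (p_i − 1). By the binomial theorem and
-- C(m,k) k! ≤ m^k, (1 + x/m)^m is at most the m-th partial sum of exp x; with m = 100x this
-- gives exp x > (27/10)^x, so it suffices to show p₁^(2^(r+1)) ≤ (27/10)^φ(n).
-- For r = 1 this is p^4 ≤ (27/10)^(p−1) for p ≥ 11. For r ≥ 2 raise p₁^4 ≤ (27/10)^(3(p₁−1))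
-- (valid for p₁ ≥ 3) to the power 2^(r−1), using ∏_{i≥2} (p_i − 1) ≥ 3·2^(r−1): for r = 2
-- because n ≠ 15 forces p₂ ≥ 7, for r ≥ 3 because each p_i − 1 ≥ 4. Both bounds on fourth
-- powers follow by induction on the base, as ((p+1)/p)^4 decreases in p.

module Submission where

open import Defs
open import Algebra.Bundles using (CommutativeSemiring)
open import Data.Bool using (Bool; true; false; _∧_; not; if_then_else_)
open import Data.Bool.Properties using (∧-identityʳ; ∧-zeroʳ)
open import Data.Fin using (toℕ)
open import Data.Integer as ℤ using (+_)
import Data.Integer.Properties as ℤ
open import Data.List using (List; []; _∷_; length; map; filter; foldr; applyUpTo; upTo)
open import Data.List.Properties using (map-upTo)
open import Data.List.Relation.Unary.All as All using (All; []; _∷_)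
open import Data.List.Relation.Unary.All.Properties using (applyUpTo⁺₁)
open import Data.List.Relation.Unary.AllPairs as AllPairs using (AllPairs; []; _∷_)
open import Data.List.Relation.Unary.Linked using (Linked)
open import Data.List.Relation.Unary.Linked.Properties using (Linked⇒AllPairs)
open import Data.Nat using (ℕ; zero; suc; _+_; _*_; _∸_; _^_; _≤_; _<_; z≤n; s≤s; s≤s⁻¹; pred; _!;
  NonZero; >-nonZero; >-nonZero⁻¹; nonTrivial⇒≢1; nonTrivial⇒n>1)
open import Data.Nat.Combinatorics using (_C_; nCk+nC[k+1]≡[n+1]C[k+1])
open import Data.Nat.Coprimality as Coprime using (Coprime; coprime?; coprime-+; coprime-divisor; 1-coprimeTo)
open import Data.Nat.Divisibility
  using (_∣_; _∣?_; divides; ∣-refl; ∣-trans; ∣1⇒≡1; ∣⇒≤; ∣m⇒∣m*n; ∣n⇒∣m*n; ∣m∣n⇒∣m+n; ∣m+n∣m⇒∣n)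
open import Data.Nat.ListAction using (sum; product)
open import Data.Nat.Primality using (Prime; prime⇒irreducible; prime⇒nonTrivial; euclidsLemma)
open import Data.Nat.Properties
open import Data.Nat.Tactic.RingSolver using (solve-∀)
open import Data.Product using (_×_; _,_)
import Data.Rational as ℚ
open import Data.Rational using (toℚᵘ; 0ℚ) renaming (_+_ to _+ℚ_)
open import Data.Rational.Properties using (toℚᵘ-fromℚᵘ; toℚᵘ-homo-+; toℚᵘ-cancel-<)
open import Data.Rational.Unnormalised as ℚᵘ using (ℚᵘ; _/_; 0ℚᵘ; _≃_; *≡*; *≤*; *<*)
  renaming (_≤_ to _≤ᵘ_; _<_ to _<ᵘ_; _+_ to _+ᵘ_)
import Data.Rational.Unnormalised.Properties as ℚᵘ
open import Data.Sum using (inj₁; inj₂)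
open import Function using (_∘_; id; _⇔_; mk⇔)
open import Relation.Binary.PropositionalEquality
open import Relation.Nullary using (¬_; does; ¬?; contradiction)
open import Relation.Nullary.Decidable using (dec-true; dec-false; does-⇔; _×-dec_)
open import Relation.Unary using (Pred; Decidable)

-- Euler's totient of a product of distinct primes

count : (ℕ → Bool) → ℕ → ℕ
count f zero    = zero
count f (suc n) = (if f 0 then 1 else 0) + count (f ∘ suc) n

length-filter-applyUpTo : ∀ {ℓ} {P : Pred ℕ ℓ} (P? : Decidable P) g n →
                          length (filter P? (applyUpTo g n)) ≡ count (λ i → does (P? (g i))) n
length-filter-applyUpTo P? g zero = refl
length-filter-applyUpTo P? g (suc n) with does (P? (g 0))
... | true  = cong suc (length-filter-applyUpTo P? (g ∘ suc) n)
... | false = length-filter-applyUpTo P? (g ∘ suc) n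

φ≡count : ∀ n → φ n ≡ count (λ i → does (coprime? (suc i) n)) n
φ≡count n = trans (cong (length ∘ filter (λ k → coprime? k n)) (map-upTo suc n))
                  (length-filter-applyUpTo (λ k → coprime? k n) suc n)

count-cong : ∀ {f g} → (∀ i → f i ≡ g i) → ∀ n → count f n ≡ count g n
count-cong f≗g zero    = refl
count-cong f≗g (suc n) =
  cong₂ (λ b c → (if b then 1 else 0) + c) (f≗g 0) (count-cong (f≗g ∘ suc) n)

count-+ : ∀ (f : ℕ → Bool) m n → count f (m + n) ≡ count f m + count (λ i → f (m + i)) n
count-+ f zero    n = refl
count-+ f (suc m) n with f 0
... | true  = cong suc (count-+ (f ∘ suc) m n)
... | false = count-+ (f ∘ suc) m n

count-split : ∀ (f g : ℕ → Bool) n → count (λ i → f i ∧ g i) n + count (λ i → f i ∧ not (g i)) n ≡ count f n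
count-split f g zero = refl
count-split f g (suc n) with f 0 | g 0
... | true  | true  = cong suc (count-split (f ∘ suc) (g ∘ suc) n)
... | true  | false = trans (+-suc _ _) (cong suc (count-split (f ∘ suc) (g ∘ suc) n))
... | false | _     = count-split (f ∘ suc) (g ∘ suc) n

count-periodic : ∀ (f : ℕ → Bool) m → (∀ i → f (m + i) ≡ f i) → ∀ k → count f (k * m) ≡ k * count f m
count-periodic f m periodic zero    = refl
count-periodic f m periodic (suc k) = begin
  count f (m + k * m)                                ≡⟨ count-+ f m (k * m) ⟩
  count f m + count (λ i → f (m + i)) (k * m)        ≡⟨ cong (_+_ (count f m)) (count-cong periodic (k * m)) ⟩
  count f m + count f (k * m)                        ≡⟨ cong (_+_ (count f m)) (count-periodic f m periodic k) ⟩
  count f m + k * count f m                          ∎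
  where open ≡-Reasoning

count-last : ∀ (f : ℕ → Bool) n → (∀ i → i < n → f i ≡ false) → count f (suc n) ≡ (if f n then 1 else 0)
count-last f zero    _        = +-identityʳ _
count-last f (suc n) vanishes rewrite vanishes 0 (s≤s z≤n) =
  count-last (f ∘ suc) n (λ i i<n → vanishes (suc i) (s≤s i<n))

count-multiples : ∀ (f : ℕ → Bool) d .{{_ : NonZero d}} m →
                  count (λ i → f (suc i) ∧ does (d ∣? suc i)) (m * d) ≡ count (λ j → f (suc j * d)) m
count-multiples f d         zero    = refl
count-multiples f d@(suc q) (suc m) = begin
  count hit (d + m * d)
    ≡⟨ count-+ hit d (m * d) ⟩
  count hit d + count (λ i → hit (d + i)) (m * d)
    ≡⟨ cong₂ _+_ first-block (count-cong shift (m * d)) ⟩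
  (if f d then 1 else 0) + count (λ i → f (d + suc i) ∧ does (d ∣? suc i)) (m * d)
    ≡⟨ cong (_+_ (if f d then 1 else 0)) (count-multiples (λ k → f (d + k)) d m) ⟩
  (if f d then 1 else 0) + count (λ j → f (suc (suc j) * d)) m
    ≡⟨ cong (λ k → (if f k then 1 else 0) + count (λ j → f (suc (suc j) * d)) m) (+-identityʳ d) ⟨
  count (λ j → f (suc j * d)) (suc m)
    ∎
  where
  open ≡-Reasoning
  hit : ℕ → Bool
  hit i = f (suc i) ∧ does (d ∣? suc i)
  first-block : count hit d ≡ (if f d then 1 else 0)
  first-block = trans (count-last hit q before-d) (cong (λ b → if b then 1 else 0) at-d)
    where
    before-d : ∀ i → i < q → hit i ≡ false
    before-d i i<q =
      trans (cong (f (suc i) ∧_) (dec-false (d ∣? suc i) (<⇒≱ (s≤s i<q) ∘ ∣⇒≤))) (∧-zeroʳ (f (suc i)))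
    at-d : hit q ≡ f d
    at-d = trans (cong (f d ∧_) (dec-true (d ∣? d) ∣-refl)) (∧-identityʳ (f d))
  shift : ∀ i → hit (d + i) ≡ f (d + suc i) ∧ does (d ∣? suc i)
  shift i = cong₂ _∧_ (cong f (sym (+-suc d i)))
    (trans (cong (λ k → does (d ∣? k)) (sym (+-suc d i)))
           (does-⇔ (mk⇔ (λ d∣d+k → ∣m+n∣m⇒∣n d∣d+k ∣-refl) (∣m∣n⇒∣m+n ∣-refl))
                   (d ∣? (d + suc i)) (d ∣? suc i)))

prime≢1 : ∀ {p} → Prime p → p ≢ 1
prime≢1 p-prime = nonTrivial⇒≢1 {{prime⇒nonTrivial p-prime}}

prime∤⇒coprime : ∀ {p n} → Prime p → ¬ p ∣ n → Coprime p n
prime∤⇒coprime p-prime p∤n (d∣p , d∣n) with prime⇒irreducible p-prime d∣p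
... | inj₁ d≡1  = d≡1
... | inj₂ refl = contradiction d∣n p∤n

coprime-prime*⇔ : ∀ {p k m} → Prime p → Coprime k (p * m) ⇔ (Coprime k m × ¬ p ∣ k)
coprime-prime*⇔ {p} {m = m} p-prime = mk⇔
  (λ coprime → (λ {_} (d∣k , d∣m) → coprime (d∣k , ∣n⇒∣m*n p d∣m))
             , (λ p∣k → prime≢1 p-prime (coprime (p∣k , ∣m⇒∣m*n m ∣-refl))))
  (λ (coprime , p∤k) {d} (d∣k , d∣pm) →
    let coprime[d,p] : Coprime d p
        coprime[d,p] = Coprime.sym (prime∤⇒coprime p-prime (λ p∣d → p∤k (∣-trans p∣d d∣k)))
    in coprime (d∣k , coprime-divisor coprime[d,p] d∣pm))

coprime-+ˡ⇔ : ∀ {m k} → Coprime (m + k) m ⇔ Coprime k m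
coprime-+ˡ⇔ = mk⇔ (λ coprime {_} (d∣k , d∣m) → coprime (∣m∣n⇒∣m+n d∣m d∣k , d∣m)) coprime-+

coprime-*ʳ⇔ : ∀ {p k m} → Coprime p m → Coprime (k * p) m ⇔ Coprime k m
coprime-*ʳ⇔ {p} {k} coprime[p,m] = mk⇔
  (λ coprime {_} (d∣k , d∣m) → coprime (∣m⇒∣m*n p d∣k , d∣m))
  (λ coprime {d} (d∣kp , d∣m) →
    let coprime[d,p] : Coprime d p
        coprime[d,p] = λ (e∣d , e∣p) → coprime[p,m] (e∣p , ∣-trans e∣d d∣m)
    in coprime (coprime-divisor coprime[d,p] (subst (d ∣_) (*-comm k p) d∣kp) , d∣m))

φ-*-prime : ∀ {p} m → Prime p → ¬ p ∣ m → φ (p * m) ≡ pred p * φ m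
φ-*-prime {p@(suc _)} m p-prime p∤m = begin
  φ (p * m)                  ≡⟨ m+n∸m≡n (φ m) (φ (p * m)) ⟨
  φ m + φ (p * m) ∸ φ m      ≡⟨ cong (_∸ φ m) φm+φpm≡p*φm ⟩
  p * φ m ∸ φ m              ≡⟨ cong (p * φ m ∸_) (*-identityˡ (φ m)) ⟨
  p * φ m ∸ 1 * φ m          ≡⟨ *-distribʳ-∸ (φ m) p 1 ⟨
  pred p * φ m               ∎
  where
  open ≡-Reasoning
  cop div : ℕ → Bool
  cop i = does (coprime? (suc i) m)
  div i = does (p ∣? suc i)
  -- Of the p φ(m) numbers in 1..pm coprime to m, those divisible by p are p j with j coprime
  -- to m, so φ(m) of them; the others are exactly the numbers coprime to pm.
  multiples : count (λ i → cop i ∧ div i) (p * m) ≡ φ m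
  multiples = begin
    count (λ i → cop i ∧ div i) (p * m)            ≡⟨ cong (count _) (*-comm p m) ⟩
    count (λ i → cop i ∧ div i) (m * p)            ≡⟨ count-multiples (λ k → does (coprime? k m)) p m ⟩
    count (λ j → does (coprime? (suc j * p) m)) m  ≡⟨ count-cong coprime[jp,m]≡coprime[j,m] m ⟩
    count cop m                                    ≡⟨ φ≡count m ⟨
    φ m                                            ∎
    where
    coprime[jp,m]≡coprime[j,m] : ∀ j → does (coprime? (suc j * p) m) ≡ cop j
    coprime[jp,m]≡coprime[j,m] j =
      does-⇔ (coprime-*ʳ⇔ (prime∤⇒coprime p-prime p∤m)) (coprime? _ m) (coprime? (suc j) m)
  non-multiples : count (λ i → cop i ∧ not (div i)) (p * m) ≡ φ (p * m)
  non-multiples = sym (trans (φ≡count (p * m)) (count-cong coprime[i,pm] (p * m)))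
    where
    coprime[i,pm] : ∀ i → does (coprime? (suc i) (p * m)) ≡ cop i ∧ not (div i)
    coprime[i,pm] i = does-⇔ (coprime-prime*⇔ p-prime) (coprime? _ _) (coprime? (suc i) m ×-dec ¬? (p ∣? suc i))
  periodic : ∀ i → cop (m + i) ≡ cop i
  periodic i = trans (cong (λ k → does (coprime? k m)) (sym (+-suc m i)))
                     (does-⇔ coprime-+ˡ⇔ (coprime? (m + suc i) m) (coprime? (suc i) m))
  φm+φpm≡p*φm : φ m + φ (p * m) ≡ p * φ m
  φm+φpm≡p*φm = begin
    φ m + φ (p * m)
      ≡⟨ cong₂ _+_ multiples non-multiples ⟨
    count (λ i → cop i ∧ div i) (p * m) + count (λ i → cop i ∧ not (div i)) (p * m)
      ≡⟨ count-split cop div (p * m) ⟩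
    count cop (p * m)
      ≡⟨ count-periodic cop m periodic p ⟩
    p * count cop m
      ≡⟨ cong (p *_) (φ≡count m) ⟨
    p * φ m
      ∎

prime∤product : ∀ {p qs} → Prime p → All Prime qs → All (p ≢_) qs → ¬ p ∣ product qs
prime∤product p-prime []                  []             p∣1   = prime≢1 p-prime (∣1⇒≡1 p∣1)
prime∤product p-prime (q-prime ∷ primes) (p≢q ∷ p≢qs) p∣qqs with euclidsLemma _ _ p-prime p∣qqs
... | inj₂ p∣qs = prime∤product p-prime primes p≢qs p∣qs
... | inj₁ p∣q with prime⇒irreducible q-prime p∣q
...   | inj₁ p≡1 = prime≢1 p-prime p≡1
...   | inj₂ p≡q = p≢q p≡q

φ-product : ∀ {ps} → All Prime ps → AllPairs _≢_ ps → φ (product ps) ≡ product (map pred ps)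
φ-product []                   []                   = refl
φ-product {p ∷ ps} (p-prime ∷ primes) (p≢ps ∷ distinct) =
  trans (φ-*-prime (product ps) p-prime (prime∤product p-prime primes p≢ps))
        (cong (pred p *_) (φ-product primes distinct))

φ-nonZero : ∀ n .{{_ : NonZero n}} → NonZero (φ n)
φ-nonZero n@(suc _) = >-nonZero (subst (0 <_) (sym (φ≡count n)) (begin-strict
  0                                                  <⟨ s≤s z≤n ⟩
  1                                                  ≡⟨ cong (λ b → if b then 1 else 0) (dec-true (coprime? 1 n) (1-coprimeTo n)) ⟨
  (if does (coprime? 1 n) then 1 else 0)             ≤⟨ m≤m+n _ _ ⟩
  count (λ i → does (coprime? (suc i) n)) n          ∎))
  where open ≤-Reasoning

-- Partial sums of the exponential series

sumᵘ : List ℚᵘ → ℚᵘ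
sumᵘ = foldr _+ᵘ_ 0ℚᵘ

sumᵘ-mono-≤ : ∀ {f g : ℕ → ℚᵘ} {ks} → All (λ k → f k ≤ᵘ g k) ks → sumᵘ (map f ks) ≤ᵘ sumᵘ (map g ks)
sumᵘ-mono-≤ []           = ℚᵘ.≤-refl
sumᵘ-mono-≤ (fk≤gk ∷ f≤g) = ℚᵘ.+-mono-≤ fk≤gk (sumᵘ-mono-≤ f≤g)

/-mono-≤ : ∀ {a b} d e .{{_ : NonZero d}} .{{_ : NonZero e}} → a * e ≤ b * d → + a / d ≤ᵘ + b / e
/-mono-≤ {a} {b} (suc _) e@(suc _) ae≤bd = *≤* (subst₂ ℤ._≤_ (ℤ.pos-* a e) (ℤ.pos-* b _) (ℤ.+≤+ ae≤bd))

/-mono-< : ∀ {a b} d e .{{_ : NonZero d}} .{{_ : NonZero e}} → a * e < b * d → + a / d <ᵘ + b / e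
/-mono-< {a} {b} (suc _) e@(suc _) ae<bd = *<* (subst₂ ℤ._<_ (ℤ.pos-* a e) (ℤ.pos-* b _) (ℤ.+<+ ae<bd))

a/d+b/d≃[a+b]/d : ∀ a b d .{{_ : NonZero d}} → + a / d +ᵘ + b / d ≃ + (a + b) / d
a/d+b/d≃[a+b]/d a b d@(suc _) = *≡* (begin
  (+ a ℤ.* + d ℤ.+ + b ℤ.* + d) ℤ.* + d  ≡⟨ cong (ℤ._* + d) (ℤ.*-distribʳ-+ (+ d) (+ a) (+ b)) ⟨
  (+ a ℤ.+ + b) ℤ.* + d ℤ.* + d          ≡⟨ ℤ.*-assoc (+ a ℤ.+ + b) (+ d) (+ d) ⟩
  (+ a ℤ.+ + b) ℤ.* (+ d ℤ.* + d)        ≡⟨ cong (ℤ._* (+ d ℤ.* + d)) (ℤ.pos-+ a b) ⟨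
  + (a + b) ℤ.* + (d * d)                ∎)
  where open ≡-Reasoning

sumᵘ-/ : ∀ (a : ℕ → ℕ) d .{{_ : NonZero d}} ks → sumᵘ (map (λ k → + a k / d) ks) ≃ + sum (map a ks) / d
sumᵘ-/ a d@(suc _) []       = *≡* refl
sumᵘ-/ a d         (k ∷ ks) = ℚᵘ.≃-trans (ℚᵘ.+-congʳ (+ a k / d) (sumᵘ-/ a d ks)) (a/d+b/d≃[a+b]/d (a k) _ d)

toℚᵘ-/ : ∀ n d .{{_ : NonZero d}} → toℚᵘ (+ n ℚ./ d) ≃ + n / d
toℚᵘ-/ n d@(suc _) = toℚᵘ-fromℚᵘ (+ n / d)

toℚᵘ-expPartial : ∀ x K →
  toℚᵘ (expPartial x K) ≃ sumᵘ (map (λ k → (+ (x ^ k) / k !) {{k !≢0}}) (upTo (suc K)))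
toℚᵘ-expPartial x K = go (upTo (suc K))
  where
  go : ∀ ks → toℚᵘ (foldr (λ k s → expTerm x k +ℚ s) 0ℚ ks) ≃ sumᵘ (map (λ k → (+ (x ^ k) / k !) {{k !≢0}}) ks)
  go []       = ℚᵘ.≃-refl
  go (k ∷ ks) = ℚᵘ.≃-trans (toℚᵘ-homo-+ (expTerm x k) _) (ℚᵘ.+-cong (toℚᵘ-/ (x ^ k) (k !) {{k !≢0}}) (go ks))

module _ where
  open CommutativeSemiring +-*-commutativeSemiring using (semiring)
  import Algebra.Properties.CommutativeSemiring.Binomial +-*-commutativeSemiring as Binomial
  open import Algebra.Properties.Semiring.Exp semiring using () renaming (_^_ to _^ˢ_)
  open import Algebra.Properties.Semiring.Mult semiring using () renaming (_×_ to _×ˢ_)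
  open import Algebra.Properties.Semiring.Sum semiring using (sum-cong-≗) renaming (sum to ∑)

  ^ˢ≡^ : ∀ x n → x ^ˢ n ≡ x ^ n
  ^ˢ≡^ x zero    = refl
  ^ˢ≡^ x (suc n) = cong (x *_) (^ˢ≡^ x n)

  ×ˢ≡* : ∀ n x → n ×ˢ x ≡ n * x
  ×ˢ≡* zero    x = refl
  ×ˢ≡* (suc n) x = cong (λ s → x + s) (×ˢ≡* n x)

  ∑≡sum-applyUpTo : ∀ n (g : ℕ → ℕ) → ∑ {n} (λ i → g (toℕ i)) ≡ sum (applyUpTo g n)
  ∑≡sum-applyUpTo zero    g = refl
  ∑≡sum-applyUpTo (suc n) g = cong (λ s → g 0 + s) (∑≡sum-applyUpTo n (λ i → g (suc i)))

  binomial-theorem : ∀ x y n → (x + y) ^ n ≡ sum (map (λ k → (n C k) * (x ^ k * y ^ (n ∸ k))) (upTo (suc n)))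
  binomial-theorem x y n = begin
    (x + y) ^ n                        ≡⟨ ^ˢ≡^ (x + y) n ⟨
    (x + y) ^ˢ n                       ≡⟨ Binomial.theorem n x y ⟩
    Binomial.binomialExpansion x y n   ≡⟨ sum-cong-≗ {suc n} (λ i → trans (×ˢ≡* (n C toℕ i) _)
                                            (cong₂ (λ u v → (n C toℕ i) * (u * v)) (^ˢ≡^ x (toℕ i)) (^ˢ≡^ y (n ∸ toℕ i)))) ⟩
    ∑ {suc n} (λ i → term (toℕ i))     ≡⟨ ∑≡sum-applyUpTo (suc n) term ⟩
    sum (applyUpTo term (suc n))       ≡⟨ cong sum (map-upTo term (suc n)) ⟨
    sum (map term (upTo (suc n)))      ∎
    where
    open ≡-Reasoning
    term : ℕ → ℕ
    term k = (n C k) * (x ^ k * y ^ (n ∸ k))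

bernoulli : ∀ n k → n ^ suc k + suc k * n ^ k ≤ suc n ^ suc k
bernoulli n zero    = ≤-reflexive (+-comm (n * 1) 1)
bernoulli n (suc k) = begin
  n ^ suc (suc k) + suc (suc k) * n ^ suc k               ≤⟨ m≤m+n _ (suc k * n ^ k) ⟩
  n ^ suc (suc k) + suc (suc k) * n ^ suc k + suc k * n ^ k ≡⟨ regroup n k (n ^ k) ⟩
  suc n * (n ^ suc k + suc k * n ^ k)                     ≤⟨ *-monoʳ-≤ (suc n) (bernoulli n k) ⟩
  suc n ^ suc (suc k)                                     ∎
  where
  open ≤-Reasoning
  regroup : ∀ n k a → n * (n * a) + suc (suc k) * (n * a) + suc k * a ≡ suc n * (n * a + suc k * a)
  regroup = solve-∀

nCk*k!≤n^k : ∀ n k → (n C k) * k ! ≤ n ^ k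
nCk*k!≤n^k n       zero    = ≤-refl
nCk*k!≤n^k zero    (suc k) = z≤n
nCk*k!≤n^k (suc n) (suc k) = begin
  (suc n C suc k) * (suc k * k !)                    ≡⟨ cong (_* (suc k * k !)) (nCk+nC[k+1]≡[n+1]C[k+1] n k) ⟨
  ((n C k) + (n C suc k)) * (suc k * k !)            ≡⟨ regroup (n C k) (n C suc k) (suc k) (k !) ⟩
  suc k * ((n C k) * k !) + (n C suc k) * suc k !    ≤⟨ +-mono-≤ (*-monoʳ-≤ (suc k) (nCk*k!≤n^k n k)) (nCk*k!≤n^k n (suc k)) ⟩
  suc k * n ^ k + n ^ suc k                          ≡⟨ +-comm _ (n ^ suc k) ⟩
  n ^ suc k + suc k * n ^ k                          ≤⟨ bernoulli n k ⟩
  suc n ^ suc k                                      ∎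
  where
  open ≤-Reasoning
  regroup : ∀ a b c f → (a + b) * (c * f) ≡ c * (a * f) + b * (c * f)
  regroup = solve-∀

binomial-term*k!≤x^k*m^m : ∀ x m k → k ≤ m → (m C k) * (x ^ k * m ^ (m ∸ k)) * k ! ≤ x ^ k * m ^ m
binomial-term*k!≤x^k*m^m x m k k≤m = begin
  (m C k) * (x ^ k * m ^ (m ∸ k)) * k !    ≡⟨ regroup (m C k) (x ^ k) (m ^ (m ∸ k)) (k !) ⟩
  x ^ k * ((m C k) * k ! * m ^ (m ∸ k))    ≤⟨ *-monoʳ-≤ (x ^ k) (*-monoˡ-≤ (m ^ (m ∸ k)) (nCk*k!≤n^k m k)) ⟩
  x ^ k * (m ^ k * m ^ (m ∸ k))            ≡⟨ cong (x ^ k *_) (^-distribˡ-+-* m k (m ∸ k)) ⟨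
  x ^ k * m ^ (k + (m ∸ k))                ≡⟨ cong (λ e → x ^ k * m ^ e) (m+[n∸m]≡n k≤m) ⟩
  x ^ k * m ^ m                            ∎
  where
  open ≤-Reasoning
  regroup : ∀ c a b f → c * (a * b) * f ≡ a * (c * f * b)
  regroup = solve-∀

[x+m]^m/m^m≤expPartial : ∀ x m .{{_ : NonZero m}} →
                         (+ ((x + m) ^ m) / m ^ m) {{m^n≢0 m m}} ≤ᵘ toℚᵘ (expPartial x m)
[x+m]^m/m^m≤expPartial x m = begin
  + ((x + m) ^ m) / m ^ m                            ≡⟨ cong (λ n → + n / m ^ m) (binomial-theorem x m m) ⟩
  + sum (map term (upTo (suc m))) / m ^ m            ≃⟨ sumᵘ-/ term (m ^ m) (upTo (suc m)) ⟨
  sumᵘ (map (λ k → + term k / m ^ m) (upTo (suc m))) ≤⟨ sumᵘ-mono-≤ {f = λ k → + term k / m ^ m}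
                                                          (applyUpTo⁺₁ id (suc m) termwise) ⟩
  sumᵘ (map (λ k → (+ (x ^ k) / k !) {{k !≢0}}) (upTo (suc m))) ≃⟨ toℚᵘ-expPartial x m ⟨
  toℚᵘ (expPartial x m)                              ∎
  where
  open ℚᵘ.≤-Reasoning
  instance
    m^m≢0 : NonZero (m ^ m)
    m^m≢0 = m^n≢0 m m
  term : ℕ → ℕ
  term k = (m C k) * (x ^ k * m ^ (m ∸ k))
  termwise : ∀ {k} → k < suc m → + term k / m ^ m ≤ᵘ (+ (x ^ k) / k !) {{k !≢0}}
  termwise {k} k<1+m = /-mono-≤ (m ^ m) (k !) {{_}} {{k !≢0}} (binomial-term*k!≤x^k*m^m x m k (s≤s⁻¹ k<1+m))

N*m^m<[x+m]^m⇒<exp : ∀ {N x} m .{{_ : NonZero m}} → N * m ^ m < (x + m) ^ m → N <exp x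
N*m^m<[x+m]^m⇒<exp {N} {x} m N*m^m<[x+m]^m = m , toℚᵘ-cancel-< (begin-strict
  toℚᵘ (+ N ℚ./ 1)              ≃⟨ toℚᵘ-/ N 1 ⟩
  + N / 1                       <⟨ /-mono-< 1 (m ^ m) (subst (N * m ^ m <_) (sym (*-identityʳ _)) N*m^m<[x+m]^m) ⟩
  + ((x + m) ^ m) / m ^ m       ≤⟨ [x+m]^m/m^m≤expPartial x m ⟩
  toℚᵘ (expPartial x m)         ∎)
  where
  open ℚᵘ.≤-Reasoning
  instance
    m^m≢0 : NonZero (m ^ m)
    m^m≢0 = m^n≢0 m m

-- Comparison with powers of 27/10

^-distribʳ-* : ∀ a b n → (a * b) ^ n ≡ a ^ n * b ^ n
^-distribʳ-* a b zero    = refl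
^-distribʳ-* a b (suc n) = trans (cong (a * b *_) (^-distribʳ-* a b n)) (interchange a b (a ^ n) (b ^ n))
  where interchange : ∀ a b c d → a * b * (c * d) ≡ a * c * (b * d)
        interchange = solve-∀

infix 4 _≤[27/10]^_

_≤[27/10]^_ : ℕ → ℕ → Set
N ≤[27/10]^ x = N * 10 ^ x ≤ 27 ^ x

-- With m = 100x, (1 + x/m)^m = ((101/100)^100)^x, and (101/100)^100 > 27/10.
≤[27/10]^⇒<exp : ∀ {N} x .{{_ : NonZero x}} → N ≤[27/10]^ x → N <exp x
≤[27/10]^⇒<exp {N} x N≤[27/10]^x = N*m^m<[x+m]^m⇒<exp {N} {x} m {{m*n≢0 100 x}} (begin-strict
  N * m ^ m                  ≡⟨ cong (N *_) (^-distribʳ-* 100 x m) ⟩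
  N * (100 ^ m * x ^ m)      ≡⟨ cong (λ a → N * (a * x ^ m)) (^-*-assoc 100 100 x) ⟨
  N * (A ^ x * x ^ m)        ≡⟨ *-assoc N (A ^ x) (x ^ m) ⟨
  N * A ^ x * x ^ m          <⟨ *-monoˡ-< (x ^ m) {{m^n≢0 x m}} N*A^x<B^x ⟩
  B ^ x * x ^ m              ≡⟨ cong (_* x ^ m) (^-*-assoc 101 100 x) ⟩
  101 ^ m * x ^ m            ≡⟨ ^-distribʳ-* 101 x m ⟨
  (101 * x) ^ m              ≡⟨⟩
  (x + m) ^ m                ∎)
  where
  open ≤-Reasoning
  m A B : ℕ
  m = 100 * x
  A = 100 ^ 100
  B = 101 ^ 100
  27*A<10*B : 27 * A < 10 * B
  27*A<10*B = ≤ᵇ⇒≤ _ _ _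
  N*A^x<B^x : N * A ^ x < B ^ x
  N*A^x<B^x = *-cancelˡ-< (10 ^ x) _ _ (begin-strict
    10 ^ x * (N * A ^ x)     ≡⟨ regroup (10 ^ x) N (A ^ x) ⟩
    N * 10 ^ x * A ^ x       ≤⟨ *-monoˡ-≤ (A ^ x) N≤[27/10]^x ⟩
    27 ^ x * A ^ x           ≡⟨ ^-distribʳ-* 27 A x ⟨
    (27 * A) ^ x             <⟨ ^-monoˡ-< x 27*A<10*B ⟩
    (10 * B) ^ x             ≡⟨ ^-distribʳ-* 10 B x ⟩
    10 ^ x * B ^ x           ∎)
    where regroup : ∀ t n a → t * (n * a) ≡ n * t * a
          regroup = solve-∀

≤[27/10]^-step : ∀ {X Y} d {e} → X ≤[27/10]^ e → Y * 10 ^ d ≤ 27 ^ d * X → Y ≤[27/10]^ (d + e)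
≤[27/10]^-step {X} {Y} d {e} X≤[27/10]^e Y*10^d≤27^d*X = begin
  Y * 10 ^ (d + e)         ≡⟨ cong (Y *_) (^-distribˡ-+-* 10 d e) ⟩
  Y * (10 ^ d * 10 ^ e)    ≡⟨ *-assoc Y _ _ ⟨
  Y * 10 ^ d * 10 ^ e      ≤⟨ *-monoˡ-≤ (10 ^ e) Y*10^d≤27^d*X ⟩
  27 ^ d * X * 10 ^ e      ≡⟨ *-assoc (27 ^ d) X _ ⟩
  27 ^ d * (X * 10 ^ e)    ≤⟨ *-monoʳ-≤ (27 ^ d) X≤[27/10]^e ⟩
  27 ^ d * 27 ^ e          ≡⟨ ^-distribˡ-+-* 27 d e ⟨
  27 ^ (d + e)             ∎
  where open ≤-Reasoning

≤[27/10]^-monoʳ : ∀ {X e E} → X ≤[27/10]^ e → e ≤ E → X ≤[27/10]^ E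
≤[27/10]^-monoʳ {X} {e} {E} X≤[27/10]^e e≤E =
  subst (X ≤[27/10]^_) (m∸n+n≡m e≤E) (≤[27/10]^-step {Y = X} (E ∸ e) X≤[27/10]^e (begin
    X * 10 ^ (E ∸ e)    ≡⟨ *-comm X _ ⟩
    10 ^ (E ∸ e) * X    ≤⟨ *-monoˡ-≤ X (^-monoˡ-≤ (E ∸ e) (≤ᵇ⇒≤ 10 27 _)) ⟩
    27 ^ (E ∸ e) * X    ∎))
  where open ≤-Reasoning

≤[27/10]^-^ : ∀ {X e} k → X ≤[27/10]^ e → X ^ k ≤[27/10]^ (e * k)
≤[27/10]^-^ {X} {e} k X≤[27/10]^e = begin
  X ^ k * 10 ^ (e * k)      ≡⟨ cong (X ^ k *_) (^-*-assoc 10 e k) ⟨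
  X ^ k * (10 ^ e) ^ k      ≡⟨ ^-distribʳ-* X (10 ^ e) k ⟨
  (X * 10 ^ e) ^ k          ≤⟨ ^-monoˡ-≤ k X≤[27/10]^e ⟩
  (27 ^ e) ^ k              ≡⟨ ^-*-assoc 27 e k ⟩
  27 ^ (e * k)              ∎
  where open ≤-Reasoning

c^k*[1+p]^k≤[1+c]^k*p^k : ∀ {c p} k → c ≤ p → c ^ k * suc p ^ k ≤ suc c ^ k * p ^ k
c^k*[1+p]^k≤[1+c]^k*p^k {c} {p} k c≤p = begin
  c ^ k * suc p ^ k      ≡⟨ ^-distribʳ-* c (suc p) k ⟨
  (c * suc p) ^ k        ≤⟨ ^-monoˡ-≤ k (subst (_≤ suc c * p) (sym (*-suc c p)) (+-monoˡ-≤ (c * p) c≤p)) ⟩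
  (suc c * p) ^ k        ≡⟨ ^-distribʳ-* (suc c) p k ⟩
  suc c ^ k * p ^ k      ∎
  where open ≤-Reasoning

[1+p]^k*10^d≤27^d*p^k : ∀ k d {c} .{{_ : NonZero c}} → suc c ^ k * 10 ^ d ≤ 27 ^ d * c ^ k →
                         ∀ {p} → c ≤ p → suc p ^ k * 10 ^ d ≤ 27 ^ d * p ^ k
[1+p]^k*10^d≤27^d*p^k k d {c} ratio {p} c≤p = *-cancelˡ-≤ (c ^ k) {{m^n≢0 c k}} (begin
  c ^ k * (suc p ^ k * 10 ^ d)     ≡⟨ *-assoc (c ^ k) _ _ ⟨
  c ^ k * suc p ^ k * 10 ^ d       ≤⟨ *-monoˡ-≤ (10 ^ d) (c^k*[1+p]^k≤[1+c]^k*p^k k c≤p) ⟩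
  suc c ^ k * p ^ k * 10 ^ d       ≡⟨ swap (suc c ^ k) (p ^ k) (10 ^ d) ⟩
  suc c ^ k * 10 ^ d * p ^ k       ≤⟨ *-monoˡ-≤ (p ^ k) ratio ⟩
  27 ^ d * c ^ k * p ^ k           ≡⟨ rotate (27 ^ d) (c ^ k) (p ^ k) ⟩
  c ^ k * (27 ^ d * p ^ k)         ∎)
  where
  open ≤-Reasoning
  swap : ∀ a b f → a * b * f ≡ a * f * b
  swap = solve-∀
  rotate : ∀ a b f → a * b * f ≡ b * (a * f)
  rotate = solve-∀

a^k≤[27/10]^pred[a]*d : ∀ k c d .{{_ : NonZero c}} →
                        c ^ k ≤[27/10]^ (pred c * d) → suc c ^ k * 10 ^ d ≤ 27 ^ d * c ^ k →
                        ∀ {a} → c ≤ a → a ^ k ≤[27/10]^ (pred a * d)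
a^k≤[27/10]^pred[a]*d k c d base ratio {a} c≤a =
  subst (λ a → a ^ k ≤[27/10]^ (pred a * d)) (m∸n+n≡m c≤a)
        (subst (λ e → (a ∸ c + c) ^ k ≤[27/10]^ (e * d)) (sym (+-∸-assoc (a ∸ c) (>-nonZero⁻¹ c)))
               (from (a ∸ c)))
  where
  from : ∀ t → (t + c) ^ k ≤[27/10]^ ((t + pred c) * d)
  from zero    = base
  from (suc t) = ≤[27/10]^-step {Y = suc (t + c) ^ k} d (from t) ([1+p]^k*10^d≤27^d*p^k k d ratio (m≤n+m c t))

p^4≤[27/10]^pred[p]*1 : ∀ {p} → 11 ≤ p → p ^ 4 ≤[27/10]^ (pred p * 1)
p^4≤[27/10]^pred[p]*1 = a^k≤[27/10]^pred[a]*d 4 11 1 (≤ᵇ⇒≤ _ _ _) (≤ᵇ⇒≤ _ _ _)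

a^2^[2+s]≤[27/10]^pred[a]*M : ∀ {a M} s → 3 ≤ a → 3 * 2 ^ s ≤ M → a ^ (2 ^ (2 + s)) ≤[27/10]^ (pred a * M)
a^2^[2+s]≤[27/10]^pred[a]*M {a} {M} s 3≤a 3*2^s≤M = ≤[27/10]^-monoʳ {a ^ (2 ^ (2 + s))}
  (subst (_≤[27/10]^ (pred a * 3 * 2 ^ s)) a^4^2^s≡a^2^[2+s]
         (≤[27/10]^-^ {a ^ 4} {pred a * 3} (2 ^ s) (a^k≤[27/10]^pred[a]*d 4 3 3 (≤ᵇ⇒≤ _ _ _) (≤ᵇ⇒≤ _ _ _) 3≤a)))
  (begin
    pred a * 3 * 2 ^ s     ≡⟨ *-assoc (pred a) 3 (2 ^ s) ⟩
    pred a * (3 * 2 ^ s)   ≤⟨ *-monoʳ-≤ (pred a) 3*2^s≤M ⟩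
    pred a * M             ∎)
  where
  open ≤-Reasoning
  a^4^2^s≡a^2^[2+s] : (a ^ 4) ^ (2 ^ s) ≡ a ^ (2 ^ (2 + s))
  a^4^2^s≡a^2^[2+s] = trans (^-*-assoc a 4 (2 ^ s)) (cong (a ^_) (*-assoc 2 2 (2 ^ s)))

-- Odd squarefree numbers

2*k≤odd⇒2*k<odd : ∀ k {n} → ¬ 2 ∣ n → 2 * k ≤ n → 2 * k < n
2*k≤odd⇒2*k<odd k n-odd 2k≤n = ≤∧≢⇒< 2k≤n (λ 2k≡n → n-odd (divides k (trans (sym 2k≡n) (*-comm 2 k))))

odd-prime⇒3≤ : ∀ {p} → Prime p → ¬ 2 ∣ p → 3 ≤ p
odd-prime⇒3≤ {p} p-prime p-odd = 2*k≤odd⇒2*k<odd 1 p-odd (nonTrivial⇒n>1 p {{prime⇒nonTrivial p-prime}})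

∤-product⇒All∤ : ∀ {d} ns → ¬ d ∣ product ns → All (λ n → ¬ d ∣ n) ns
∤-product⇒All∤ []       _       = []
∤-product⇒All∤ (n ∷ ns) d∤n*ns =
  (λ d∣n → d∤n*ns (∣m⇒∣m*n (product ns) d∣n)) ∷ ∤-product⇒All∤ ns (λ d∣ns → d∤n*ns (∣n⇒∣m*n n d∣ns))

p*q≢15⇒7≤q : ∀ {p q} → 3 ≤ p → p < q → ¬ 2 ∣ p → ¬ 2 ∣ q → p * q ≢ 15 → 7 ≤ q
p*q≢15⇒7≤q {p} {q} 3≤p p<q p-odd q-odd pq≢15 = 2*k≤odd⇒2*k<odd 3 q-odd (≤∧≢⇒< 5≤q 5≢q)
  where
  5≤q : 5 ≤ q
  5≤q = 2*k≤odd⇒2*k<odd 2 q-odd (≤-trans (s≤s 3≤p) p<q)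
  5≢q : 5 ≢ q
  5≢q 5≡q = pq≢15 (cong₂ _*_ p≡3 (sym 5≡q))
    where
    p≡3 : p ≡ 3
    p≡3 = ≤-antisym (≮⇒≥ (λ 3<p → <⇒≱ (subst (p <_) (sym 5≡q) p<q) (2*k≤odd⇒2*k<odd 2 p-odd 3<p))) 3≤p

c^length≤product-pred : ∀ {c ns} → All (c <_) ns → c ^ length ns ≤ product (map pred ns)
c^length≤product-pred []           = ≤-refl
c^length≤product-pred (c<n ∷ c<ns) = *-mono-≤ (pred-mono-≤ c<n) (c^length≤product-pred c<ns)

3*2^s≤4^s : ∀ {s} → 2 ≤ s → 3 * 2 ^ s ≤ 4 ^ s
3*2^s≤4^s {s} 2≤s = begin
  3 * 2 ^ s        ≤⟨ *-monoˡ-≤ (2 ^ s) (≤-trans (n≤1+n 3) (^-monoʳ-≤ 2 2≤s)) ⟩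
  2 ^ s * 2 ^ s    ≡⟨ ^-distribʳ-* 2 2 s ⟨
  4 ^ s            ∎
  where open ≤-Reasoning

p^2^[1+r]≤[27/10]^∏pred : ∀ {p} qs → 3 ≤ p → All (p <_) qs → All (λ n → ¬ 2 ∣ n) (p ∷ qs) →
                          11 ≤ product (p ∷ qs) → product (p ∷ qs) ≢ 15 →
                          p ^ (2 ^ suc (length (p ∷ qs))) ≤[27/10]^ product (map pred (p ∷ qs))
p^2^[1+r]≤[27/10]^∏pred {p} [] _ [] _ 11≤p*1 _ =
  p^4≤[27/10]^pred[p]*1 (subst (11 ≤_) (*-identityʳ p) 11≤p*1)
p^2^[1+r]≤[27/10]^∏pred {p} (q ∷ []) 3≤p (p<q ∷ []) (p-odd ∷ q-odd ∷ []) _ p*q*1≢15 =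
  a^2^[2+s]≤[27/10]^pred[a]*M 1 3≤p (subst (6 ≤_) (sym (*-identityʳ (pred q))) (pred-mono-≤ 7≤q))
  where
  7≤q : 7 ≤ q
  7≤q = p*q≢15⇒7≤q 3≤p p<q p-odd q-odd (λ p*q≡15 → p*q*1≢15 (trans (cong (p *_) (*-identityʳ q)) p*q≡15))
p^2^[1+r]≤[27/10]^∏pred {p} qs@(_ ∷ _ ∷ _) 3≤p p<qs (_ ∷ qs-odd) _ _ =
  a^2^[2+s]≤[27/10]^pred[a]*M (length qs) 3≤p
    (≤-trans (3*2^s≤4^s {length qs} (s≤s (s≤s z≤n))) (c^length≤product-pred (All.zipWith 4<q (p<qs , qs-odd))))
  where
  4<q : ∀ {q} → p < q × ¬ 2 ∣ q → 4 < q
  4<q (p<q , q-odd) = 2*k≤odd⇒2*k<odd 2 q-odd (≤-trans (s≤s 3≤p) p<q)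

lemma4p2 : (p₁ : ℕ) (ps : List ℕ) → All Prime (p₁ ∷ ps) → Linked _<_ (p₁ ∷ ps) →
           ¬ (2 ∣ product (p₁ ∷ ps)) → 11 ≤ product (p₁ ∷ ps) → product (p₁ ∷ ps) ≢ 15 →
           (p₁ ^ (2 ^ suc (length (p₁ ∷ ps)))) <exp φ (product (p₁ ∷ ps))
lemma4p2 p₁ ps primes sorted n-odd 11≤n n≢15 =
  ≤[27/10]^⇒<exp {N} (φ n) {{φ-nonZero n {{>-nonZero (≤-trans (s≤s z≤n) 11≤n)}}}}
    (subst (N ≤[27/10]^_) (sym (φ-product primes (AllPairs.map <⇒≢ increasing)))
           (p^2^[1+r]≤[27/10]^∏pred ps 3≤p₁ (AllPairs.head increasing) odd 11≤n n≢15))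
  where
  N n : ℕ
  N = p₁ ^ (2 ^ suc (length (p₁ ∷ ps)))
  n = product (p₁ ∷ ps)
  increasing : AllPairs _<_ (p₁ ∷ ps)
  increasing = Linked⇒AllPairs <-trans sorted
  odd : All (λ q → ¬ 2 ∣ q) (p₁ ∷ ps)
  odd = ∤-product⇒All∤ (p₁ ∷ ps) n-odd
  3≤p₁ : 3 ≤ p₁
  3≤p₁ = odd-prime⇒3≤ (All.head primes) (All.head odd)
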